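{- Let $m$ be a positive integer, and let $c_1 = 5\cdot 2^{m+2}+3$ (binary $101\underbrace{0\cdots0}_{m}11$) and $c_2=3\cdot 2^{m+1}+1$ (binary $11\underbrace{0\cdots0}_{m}1$). Then there exists an addition chain for $2^{c_1}-1$ which contains $2^{c_2}-1$ and has length $\ell(c_1)+c_1=c_1+m+6$.
   Context: An addition chain for a positive integer $N$ is a sequence of integers $1=a_0<a_1<\cdots<a_r=N$ such that each $a_k$ ($k\geq 1$) equals $a_i+a_j$ for some $i,j<k$ (with $i=j$ allowed); $r$ is its length. $\ell(N)$ denotes the smallest length of an addition chain for $N$. -}

module Defs where

open import Data.Nat using (ℕ; zero; suc; _+_; _*_; _∸_; _^_; _<_; _≤_)
open import Data.Fin using (Fin; toℕ; fromℕ) renaming (zero to fzero; suc to fsuc)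
open import Data.Product using (Σ; ∃; _×_; _,_)
open import Relation.Binary.PropositionalEquality using (_≡_)
open import Relation.Nullary using (¬_)

record AdditionChain (N r : ℕ) : Set where
  field
    a        : Fin (suc r) → ℕ
    start    : a fzero ≡ 1
    strict   : ∀ (i j : Fin (suc r)) → toℕ i < toℕ j → a i < a j
    finish   : a (fromℕ r) ≡ N
    additive : ∀ (k : Fin (suc r)) → 1 ≤ toℕ k →
               Σ (Fin (suc r)) λ i → Σ (Fin (suc r)) λ j →
                 (toℕ i < toℕ k) × (toℕ j < toℕ k) × (a k ≡ a i + a j)

Contains : ∀ {N r} → AdditionChain N r → ℕ → Set
Contains {N} {r} ch x = Σ (Fin (suc r)) λ k → AdditionChain.a ch k ≡ x

ℓ≡ : ℕ → ℕ → Set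
ℓ≡ N r = AdditionChain N r × (∀ s → s < r → ¬ AdditionChain N s)

c₁ : ℕ → ℕ
c₁ m = 5 * 2 ^ (m + 2) + 3

c₂ : ℕ → ℕ
c₂ m = 3 * 2 ^ (m + 1) + 1

-- For c₁: 1, 2, 3, 5, then m + 2 doublings, then + 3. For
-- 2^c₁ − 1 (Brauer's construction): since 2^(e+d) − 1 = 2^d (2^e − 1) + (2^d − 1), a chain
-- ending in 2^e − 1 and containing 2^d − 1 reaches 2^(e+d) − 1 in d + 1 steps; follow the
-- exponents 1, 2, 4, …, q, 2q, 3q, 3q + 1, 2(3q + 1), 3(3q + 1), 3(3q + 1) + q with q = 2^(m+1),
-- which pass through c₂ = 3q + 1 and end at c₁ = 10q + 3.
--
-- Lower bound: every term of a chain satisfies a_t = 2^t or a_t ≤ 3·2^(t−2). In a chain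
-- a₀ < … < a_(n+3), if a_(n+2) = 2^(n+2) then a_(n+1) = 2^(n+1) and all earlier terms are ≤ 2^n,
-- so a_(n+3) is a sum of two even numbers or at most 2^(n+2) + 2^n; otherwise a_(n+3) = 2a_(n+2)
-- or a_(n+3) ≤ a_(n+2) + a_(n+1) ≤ 3·2^n + 2^(n+1). So a_(n+3) is even or at most 5·2^n, and as
-- c₁ = 5·2^(m+2) + 3 is odd, a chain for it has length ≥ m + 6 (shorter ones stay below 2^(m+4)).
module Submission where

open import Defs
open import Data.Bool using (if_then_else_)
open import Data.Empty using (⊥-elim)
open import Data.Fin using (Fin; toℕ; fromℕ; fromℕ<)
open import Data.Fin.Properties using (toℕ<n; toℕ-fromℕ; toℕ-fromℕ<; fromℕ<-toℕ)
open import Data.Nat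
open import Data.Nat.Divisibility using (_∣_; divides; m∣m*n; ∣m∣n⇒∣m+n; ∣m+n∣m⇒∣n; ∣n⇒∣m*n)
open import Data.Nat.Properties
open import Data.Nat.Tactic.RingSolver using (solve-∀)
open import Data.Product using (Σ; ∃-syntax; _×_; _,_)
open import Data.Sum using (_⊎_; inj₁; inj₂; [_,_]′)
open import Function using (id; _∘_)
open import Relation.Binary.PropositionalEquality
open import Relation.Nullary using (¬_; yes; no; does)
open import Relation.Nullary.Decidable using (dec-true; dec-false)

2*n≡n+n : ∀ n → 2 * n ≡ n + n
2*n≡n+n n = cong (n +_) (+-identityʳ n)

-- Addition chains indexed by ℕ rather than Fin (suc r), so that they can be extended;
-- the terms beyond index r carry no meaning.
record Chain (r : ℕ) : Set where
  field
    term     : ℕ → ℕ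
    term-0   : term 0 ≡ 1
    term-<   : ∀ {k} → k < r → term k < term (suc k)
    term-sum : ∀ {k} → 0 < k → k ≤ r → ∃[ i ] ∃[ j ] i < k × j < k × term k ≡ term i + term j

  last : ℕ
  last = term r

open Chain public

infix 4 _∈_ _⊆_

_∈_ : ∀ {r} → ℕ → Chain r → Set
_∈_ {r} v c = ∃[ k ] k ≤ r × term c k ≡ v

_⊆_ : ∀ {r r′} → Chain r → Chain r′ → Set
c ⊆ c′ = ∀ {v} → v ∈ c → v ∈ c′

module _ {r} (c : Chain r) where

  term-mono-< : ∀ {i j} → i < j → j ≤ r → term c i < term c j
  term-mono-< {i} {suc j} i<1+j 1+j≤r with m<1+n⇒m<n∨m≡n i<1+j
  ... | inj₁ i<j  = <-trans (term-mono-< i<j (<⇒≤ 1+j≤r)) (term-< c 1+j≤r)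
  ... | inj₂ refl = term-< c 1+j≤r

  term-mono-≤ : ∀ {i j} → i ≤ j → j ≤ r → term c i ≤ term c j
  term-mono-≤ i≤j j≤r with m≤n⇒m<n∨m≡n i≤j
  ... | inj₁ i<j  = <⇒≤ (term-mono-< i<j j≤r)
  ... | inj₂ refl = ≤-refl

  one-∈ : 1 ∈ c
  one-∈ = 0 , z≤n , term-0 c

  last-∈ : last c ∈ c
  last-∈ = r , ≤-refl , refl

  ∈⇒>0 : ∀ {v} → v ∈ c → 0 < v
  ∈⇒>0 (k , k≤r , refl) = subst (_≤ term c k) (term-0 c) (term-mono-≤ z≤n k≤r)

toAdditionChain : ∀ {r N} (c : Chain r) → last c ≡ N → AdditionChain N r
toAdditionChain {r} c refl = record
  { a        = term c ∘ toℕ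
  ; start    = term-0 c
  ; strict   = λ _ j i<j → term-mono-< c i<j (≤-pred (toℕ<n j))
  ; finish   = cong (term c) (toℕ-fromℕ r)
  ; additive = additive
  }
  where
  index : ∀ {i} (k : Fin (suc r)) → i < toℕ k → Σ (Fin (suc r)) λ i′ → toℕ i′ ≡ i
  index k i<k = fromℕ< (<-trans i<k (toℕ<n k)) , toℕ-fromℕ< _
  additive : ∀ (k : Fin (suc r)) → 1 ≤ toℕ k →
    Σ (Fin (suc r)) λ i → Σ (Fin (suc r)) λ j →
      toℕ i < toℕ k × toℕ j < toℕ k × term c (toℕ k) ≡ term c (toℕ i) + term c (toℕ j)
  additive k 0<k with term-sum c 0<k (≤-pred (toℕ<n k))
  ... | i , j , i<k , j<k , e with index k i<k | index k j<k
  ...   | i′ , refl | j′ , refl = i′ , j′ , i<k , j<k , e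

∈⇒Contains : ∀ {r N v} (c : Chain r) (last≡ : last c ≡ N) → v ∈ c → Contains (toAdditionChain c last≡) v
∈⇒Contains c refl (k , k≤r , tₖ≡) = fromℕ< (s≤s k≤r) , trans (cong (term c) (toℕ-fromℕ< (s≤s k≤r))) tₖ≡

toAdditionChain-∋ : ∀ {r N v} → Σ (Chain r) (λ c → last c ≡ N × v ∈ c) →
                    Σ (AdditionChain N r) (λ ch → Contains ch v)
toAdditionChain-∋ (c , last≡ , v∈c) = toAdditionChain c last≡ , ∈⇒Contains c last≡ v∈c

fromAdditionChain : ∀ {N s} → AdditionChain N s → Σ (Chain s) λ c → last c ≡ N
fromAdditionChain {N} {s} ch = record { term = t ; term-0 = t₀ ; term-< = t-< ; term-sum = t-sum } , t-last
  where
  open AdditionChain ch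
  t : ℕ → ℕ
  t k with k <? suc s
  ... | yes k<1+s = a (fromℕ< k<1+s)
  ... | no  _     = 0
  t≡a : ∀ {k} (k<1+s : k < suc s) → t k ≡ a (fromℕ< k<1+s)
  t≡a {k} k<1+s with k <? suc s
  ... | yes _     = refl
  ... | no  k≮1+s = ⊥-elim (k≮1+s k<1+s)
  t-toℕ : ∀ i → t (toℕ i) ≡ a i
  t-toℕ i = trans (t≡a (toℕ<n i)) (cong a (fromℕ<-toℕ i (toℕ<n i)))
  t₀ : t 0 ≡ 1
  t₀ = trans (t≡a z<s) start
  t-last : t s ≡ N
  t-last = trans (cong t (sym (toℕ-fromℕ s))) (trans (t-toℕ (fromℕ s)) finish)
  t-< : ∀ {k} → k < s → t k < t (suc k)
  t-< {k} k<s = begin-strict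
    t k                ≡⟨ t≡a k<1+s ⟩
    a (fromℕ< k<1+s)   <⟨ strict _ _ (subst₂ _<_ (sym (toℕ-fromℕ< k<1+s)) (sym (toℕ-fromℕ< 1+k<1+s)) (n<1+n k)) ⟩
    a (fromℕ< 1+k<1+s) ≡⟨ t≡a 1+k<1+s ⟨
    t (suc k)          ∎
    where
    open ≤-Reasoning hiding (strict)
    k<1+s : k < suc s
    k<1+s = m<n⇒m<1+n k<s
    1+k<1+s : suc k < suc s
    1+k<1+s = s<s k<s
  t-sum : ∀ {k} → 0 < k → k ≤ s → ∃[ i ] ∃[ j ] i < k × j < k × t k ≡ t i + t j
  t-sum {k} 0<k k≤s with additive (fromℕ< (s≤s k≤s)) (subst (0 <_) (sym (toℕ-fromℕ< (s≤s k≤s))) 0<k)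
  ... | i , j , i< , j< , e = toℕ i , toℕ j ,
        subst (toℕ i <_) (toℕ-fromℕ< (s≤s k≤s)) i< ,
        subst (toℕ j <_) (toℕ-fromℕ< (s≤s k≤s)) j< ,
        trans (t≡a (s≤s k≤s)) (trans e (sym (cong₂ _+_ (t-toℕ i) (t-toℕ j))))

module _ {r} (c : Chain r) where

  term-suc≤term+term : ∀ {k} → suc k ≤ r → term c (suc k) ≤ term c k + term c k
  term-suc≤term+term {k} 1+k≤r with term-sum c z<s 1+k≤r
  ... | i , j , s≤s i≤k , s≤s j≤k , e = begin
    term c (suc k)      ≡⟨ e ⟩
    term c i + term c j ≤⟨ +-mono-≤ (term-mono-≤ c i≤k k≤r) (term-mono-≤ c j≤k k≤r) ⟩
    term c k + term c k ∎
    where open ≤-Reasoning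
          k≤r : k ≤ r
          k≤r = <⇒≤ 1+k≤r

  term≤2^ : ∀ {k} → k ≤ r → term c k ≤ 2 ^ k
  term≤2^ {zero}  _     = ≤-reflexive (term-0 c)
  term≤2^ {suc k} 1+k≤r = begin
    term c (suc k)        ≤⟨ term-suc≤term+term 1+k≤r ⟩
    term c k + term c k   ≤⟨ +-mono-≤ ih ih ⟩
    2 ^ k + 2 ^ k         ≡⟨ 2*n≡n+n (2 ^ k) ⟨
    2 ^ suc k             ∎
    where open ≤-Reasoning
          ih : term c k ≤ 2 ^ k
          ih = term≤2^ (<⇒≤ 1+k≤r)

  ≤1+k⇒≡∨term≤ : ∀ {i k} → i ≤ 1 + k → 1 + k ≤ r → i ≡ 1 + k ⊎ term c i ≤ term c k
  ≤1+k⇒≡∨term≤ {k = k} i≤1+k 1+k≤r with m≤n⇒m<n∨m≡n i≤1+k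
  ... | inj₁ (s≤s i≤k) = inj₂ (term-mono-≤ c i≤k (≤-trans (n≤1+n k) 1+k≤r))
  ... | inj₂ i≡1+k     = inj₁ i≡1+k

  term-double∨≤ : ∀ {k} → 2 + k ≤ r →
    term c (2 + k) ≡ term c (1 + k) + term c (1 + k) ⊎ term c (2 + k) ≤ term c (1 + k) + term c k
  term-double∨≤ {k} 2+k≤r with term-sum c z<s 2+k≤r
  ... | i , j , s≤s i≤1+k , s≤s j≤1+k , e
    with ≤1+k⇒≡∨term≤ i≤1+k (<⇒≤ 2+k≤r) | ≤1+k⇒≡∨term≤ j≤1+k (<⇒≤ 2+k≤r)
  ...   | inj₁ refl | inj₁ refl = inj₁ e
  ...   | inj₁ refl | inj₂ tj≤  = inj₂ (≤-trans (≤-reflexive e) (+-monoʳ-≤ (term c (1 + k)) tj≤))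
  ...   | inj₂ ti≤  | inj₁ refl =
    inj₂ (≤-trans (≤-reflexive (trans e (+-comm (term c i) _))) (+-monoʳ-≤ (term c (1 + k)) ti≤))
  ...   | inj₂ ti≤  | inj₂ tj≤  =
    inj₂ (≤-trans (≤-reflexive e) (+-mono-≤ (≤-trans ti≤ (<⇒≤ (term-< c (<⇒≤ 2+k≤r)))) tj≤))

  term≡2^∨4*term≤3*2^ : ∀ {t} → t ≤ r → term c t ≡ 2 ^ t ⊎ 4 * term c t ≤ 3 * 2 ^ t
  term≡2^∨4*term≤3*2^ {zero} _ = inj₁ (term-0 c)
  term≡2^∨4*term≤3*2^ {suc zero} 1≤r with term-sum c z<s 1≤r
  ... | zero , zero , s≤s z≤n , s≤s z≤n , e = inj₁ (trans e (cong₂ _+_ (term-0 c) (term-0 c)))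
  term≡2^∨4*term≤3*2^ {suc (suc k)} 2+k≤r
    with term≡2^∨4*term≤3*2^ (<⇒≤ 2+k≤r) | term-double∨≤ 2+k≤r
  ... | inj₁ t₁≡ | inj₁ t₂≡ = inj₁ (begin
    term c (2 + k)                  ≡⟨ t₂≡ ⟩
    term c (1 + k) + term c (1 + k) ≡⟨ cong₂ _+_ t₁≡ t₁≡ ⟩
    2 ^ (1 + k) + 2 ^ (1 + k)       ≡⟨ 2*n≡n+n (2 ^ (1 + k)) ⟨
    2 ^ (2 + k)                     ∎)
    where open ≡-Reasoning
  ... | inj₁ t₁≡ | inj₂ t₂≤ = inj₂ (begin
    4 * term c (2 + k)              ≤⟨ *-monoʳ-≤ 4 t₂≤ ⟩
    4 * (term c (1 + k) + term c k) ≤⟨ *-monoʳ-≤ 4 (+-mono-≤ (≤-reflexive t₁≡) (term≤2^ k≤r)) ⟩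
    4 * (2 ^ (1 + k) + 2 ^ k)       ≡⟨ identity (2 ^ k) ⟩
    3 * 2 ^ (2 + k)                 ∎)
    where open ≤-Reasoning
          identity : ∀ x → 4 * (2 * x + x) ≡ 3 * (2 * (2 * x))
          identity = solve-∀
          k≤r : k ≤ r
          k≤r = ≤-trans (n≤1+n k) (≤-trans (n≤1+n (suc k)) 2+k≤r)
  ... | inj₂ 4t₁≤ | _ = inj₂ (begin
    4 * term c (2 + k)                      ≤⟨ *-monoʳ-≤ 4 (term-suc≤term+term 2+k≤r) ⟩
    4 * (term c (1 + k) + term c (1 + k))   ≡⟨ *-distribˡ-+ 4 (term c (1 + k)) _ ⟩
    4 * term c (1 + k) + 4 * term c (1 + k) ≤⟨ +-mono-≤ 4t₁≤ 4t₁≤ ⟩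
    3 * 2 ^ (1 + k) + 3 * 2 ^ (1 + k)       ≡⟨ *-distribˡ-+ 3 (2 ^ (1 + k)) _ ⟨
    3 * (2 ^ (1 + k) + 2 ^ (1 + k))         ≡⟨ cong (3 *_) (2*n≡n+n (2 ^ (1 + k))) ⟨
    3 * 2 ^ (2 + k)                         ∎)
    where open ≤-Reasoning

  term-suc≡2^⇒term≡2^ : ∀ {t} → suc t ≤ r → term c (suc t) ≡ 2 ^ suc t → term c t ≡ 2 ^ t
  term-suc≡2^⇒term≡2^ {t} 1+t≤r t₁≡ = ≤-antisym (term≤2^ (<⇒≤ 1+t≤r)) (*-cancelˡ-≤ 2 (begin
    2 ^ suc t            ≡⟨ t₁≡ ⟨
    term c (suc t)       ≤⟨ term-suc≤term+term 1+t≤r ⟩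
    term c t + term c t  ≡⟨ 2*n≡n+n (term c t) ⟨
    2 * term c t         ∎))
    where open ≤-Reasoning

2∣n+n : ∀ n → 2 ∣ n + n
2∣n+n n = subst (2 ∣_) (2*n≡n+n n) (m∣m*n n)

2∣a∨a≤q⇒2∣a+b∨a+b≤5q : ∀ {a b q} → a ≤ 4 * q → b ≤ 4 * q →
  2 ∣ a ⊎ a ≤ q → 2 ∣ b ⊎ b ≤ q → 2 ∣ a + b ⊎ a + b ≤ 5 * q
2∣a∨a≤q⇒2∣a+b∨a+b≤5q _ _ (inj₁ 2∣a) (inj₁ 2∣b) = inj₁ (∣m∣n⇒∣m+n 2∣a 2∣b)
2∣a∨a≤q⇒2∣a+b∨a+b≤5q _ b≤4q (inj₂ a≤q) _ = inj₂ (+-mono-≤ a≤q b≤4q)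
2∣a∨a≤q⇒2∣a+b∨a+b≤5q {q = q} a≤4q _ _ (inj₂ b≤q) =
  inj₂ (≤-trans (+-mono-≤ a≤4q b≤q) (≤-reflexive (+-comm (4 * q) q)))

2∣last∨last≤5*2^n : ∀ {n} (c : Chain (3 + n)) → 2 ∣ last c ⊎ last c ≤ 5 * 2 ^ n
2∣last∨last≤5*2^n {n} c with term≡2^∨4*term≤3*2^ c {2 + n} (n≤1+n _)
... | inj₂ 4t₂≤ with term-double∨≤ c {1 + n} ≤-refl
...   | inj₁ t₃≡ = inj₁ (subst (2 ∣_) (sym t₃≡) (2∣n+n (term c (2 + n))))
...   | inj₂ t₃≤ = inj₂ (begin
  last c                            ≤⟨ t₃≤ ⟩
  term c (2 + n) + term c (1 + n)   ≤⟨ +-mono-≤ t₂≤ (term≤2^ c (m≤n+m (1 + n) 2)) ⟩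
  3 * 2 ^ n + 2 * 2 ^ n             ≡⟨ *-distribʳ-+ (2 ^ n) 3 2 ⟨
  5 * 2 ^ n                         ∎)
  where
  open ≤-Reasoning
  t₂≤ : term c (2 + n) ≤ 3 * 2 ^ n
  t₂≤ = *-cancelˡ-≤ 4 (≤-trans 4t₂≤ (≤-reflexive (identity (2 ^ n))))
    where identity : ∀ x → 3 * (2 * (2 * x)) ≡ 4 * (3 * x)
          identity = solve-∀
2∣last∨last≤5*2^n {n} c | inj₁ t₂≡ with term-sum c {3 + n} z<s ≤-refl
... | i , j , s≤s i≤2+n , s≤s j≤2+n , t₃≡ =
  subst (λ t → 2 ∣ t ⊎ t ≤ 5 * 2 ^ n) (sym t₃≡)
    (2∣a∨a≤q⇒2∣a+b∨a+b≤5q (≤4*2^n i≤2+n) (≤4*2^n j≤2+n) (2∣∨≤2^n i≤2+n) (2∣∨≤2^n j≤2+n))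
  where
  ≤4*2^n : ∀ {i} → i ≤ 2 + n → term c i ≤ 4 * 2 ^ n
  ≤4*2^n i≤2+n = ≤-trans (term-mono-≤ c i≤2+n (n≤1+n _))
                         (≤-reflexive (trans t₂≡ (sym (*-assoc 2 2 (2 ^ n)))))
  2∣∨≤2^n : ∀ {i} → i ≤ 2 + n → 2 ∣ term c i ⊎ term c i ≤ 2 ^ n
  2∣∨≤2^n i≤2+n with m≤n⇒m<n∨m≡n i≤2+n
  ... | inj₂ refl = inj₁ (subst (2 ∣_) (sym t₂≡) (m∣m*n (2 ^ (1 + n))))
  ... | inj₁ (s≤s i≤1+n) with m≤n⇒m<n∨m≡n i≤1+n
  ...   | inj₂ refl = inj₁ (subst (2 ∣_) (sym (term-suc≡2^⇒term≡2^ c (n≤1+n _) t₂≡)) (m∣m*n (2 ^ n)))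
  ...   | inj₁ (s≤s i≤n) = inj₂ (≤-trans (term≤2^ c (≤-trans i≤n (m≤n+m n 3))) (^-monoʳ-≤ 2 i≤n))

¬2∣5*2^[1+n]+3 : ∀ n → ¬ 2 ∣ 5 * 2 ^ suc n + 3
¬2∣5*2^[1+n]+3 n 2∣ = 2∤3 (∣m+n∣m⇒∣n 2∣ (∣n⇒∣m*n 5 (m∣m*n (2 ^ n))))
  where
  2∤3 : ¬ 2 ∣ 3
  2∤3 (divides (suc (suc _)) ())

length≥5+n : ∀ {n s} (c : Chain s) → last c ≡ 5 * 2 ^ suc n + 3 → 5 + n ≤ s
length≥5+n {n} {s} c last≡ = ≮⇒≥ s≮5+n
  where
  p : ℕ
  p = 2 ^ suc n
  s≮5+n : ¬ s < 5 + n
  s≮5+n s<5+n with m<1+n⇒m<n∨m≡n s<5+n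
  ... | inj₂ refl = [ ¬2∣5*2^[1+n]+3 n ∘ subst (2 ∣_) last≡
                    , m+1+n≰m (5 * p) ∘ subst (_≤ 5 * p) last≡ ]′ (2∣last∨last≤5*2^n c)
  ... | inj₁ (s≤s s≤3+n) = <⇒≱ (≤-<-trans (m≤n+m (4 * p) p) (m<m+n (5 * p) z<s)) (begin
    5 * p + 3      ≡⟨ last≡ ⟨
    last c         ≤⟨ term≤2^ c ≤-refl ⟩
    2 ^ s          ≤⟨ ^-monoʳ-≤ 2 s≤3+n ⟩
    2 * (2 * p)    ≡⟨ *-assoc 2 2 p ⟨
    4 * p          ∎)
    where open ≤-Reasoning

singleton : Chain 0
singleton = record
  { term     = λ _ → 1
  ; term-0   = refl
  ; term-<   = λ ()
  ; term-sum = λ { {suc _} _ () }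
  }

record Extension {r} (c : Chain r) (r′ v : ℕ) : Set where
  field
    chain : Chain r′
    ends  : last chain ≡ v
    grows : c ⊆ chain

open Extension public

ends-∈ : ∀ {r r′ v} {c : Chain r} (E : Extension c r′ v) → v ∈ chain E
ends-∈ E = subst (_∈ chain E) (ends E) (last-∈ (chain E))

append : ∀ {r z} (c : Chain r) → z ∈ c → Extension c (suc r) (last c + z)
append {r} c (j , j≤r , refl) = record
  { chain = record { term = t ; term-0 = trans (old z≤n) (term-0 c) ; term-< = t-< ; term-sum = t-sum }
  ; ends  = new
  ; grows = λ (k , k≤r , tₖ≡) → k , m≤n⇒m≤1+n k≤r , trans (old k≤r) tₖ≡
  }
  where
  t : ℕ → ℕ
  t k = if does (k ≤? r) then term c k else last c + term c j
  old : ∀ {k} → k ≤ r → t k ≡ term c k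
  old {k} k≤r rewrite dec-true (k ≤? r) k≤r = refl
  new : t (suc r) ≡ last c + term c j
  new rewrite dec-false (suc r ≤? r) (n≮n r) = refl
  t-< : ∀ {k} → k < suc r → t k < t (suc k)
  t-< {k} k<1+r with m<1+n⇒m<n∨m≡n k<1+r
  ... | inj₁ k<r  rewrite old (<⇒≤ k<r) | old k<r = term-< c k<r
  ... | inj₂ refl rewrite old (≤-refl {k}) | new  = m<m+n (last c) (∈⇒>0 c (j , j≤r , refl))
  t-sum : ∀ {k} → 0 < k → k ≤ suc r → ∃[ i ] ∃[ i′ ] i < k × i′ < k × t k ≡ t i + t i′
  t-sum {k} 0<k k≤1+r with m≤n⇒m<n∨m≡n k≤1+r
  ... | inj₁ (s≤s k≤r) with term-sum c 0<k k≤r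
  ...   | i , i′ , i<k , i′<k , e = i , i′ , i<k , i′<k , (begin
    t k                  ≡⟨ old k≤r ⟩
    term c k             ≡⟨ e ⟩
    term c i + term c i′ ≡⟨ cong₂ _+_ (old (≤-trans (<⇒≤ i<k) k≤r)) (old (≤-trans (<⇒≤ i′<k) k≤r)) ⟨
    t i + t i′           ∎)
    where open ≡-Reasoning
  t-sum 0<k k≤1+r | inj₂ refl = r , j , ≤-refl , s≤s j≤r , (begin
    t (suc r)           ≡⟨ new ⟩
    last c + term c j   ≡⟨ cong₂ _+_ (old ≤-refl) (old j≤r) ⟨
    t r + t j           ∎)
    where open ≡-Reasoning

infixl 5 _⨾_ _▹_

_⨾_ : ∀ {r r₁ r₂ u v} {c : Chain r} (E : Extension c r₁ u) → Extension (chain E) r₂ v → Extension c r₂ v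
E ⨾ F = record { chain = chain F ; ends = ends F ; grows = grows F ∘ grows E }

_▹_ : ∀ {r r′ u z} {c : Chain r} (E : Extension c r′ u) → z ∈ chain E → Extension c (suc r′) (u + z)
_▹_ {z = z} {c} E z∈ = subst (Extension c _) (cong (_+ z) (ends E)) (E ⨾ append (chain E) z∈)

extension-refl : ∀ {r} (c : Chain r) → Extension c r (last c)
extension-refl c = record { chain = c ; ends = refl ; grows = id }

doublings : ∀ {r} (c : Chain r) d → Extension c (d + r) (2 ^ d * last c)
doublings     c zero    = subst (Extension c _) (sym (*-identityˡ (last c))) (extension-refl c)
doublings {r} c (suc d) = subst (Extension c _) 2^d*x+2^d*x≡2^1+d*x (E ▹ ends-∈ E)
  where
  E : Extension c (d + r) (2 ^ d * last c)
  E = doublings c d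
  2^d*x+2^d*x≡2^1+d*x : 2 ^ d * last c + 2 ^ d * last c ≡ 2 ^ suc d * last c
  2^d*x+2^d*x≡2^1+d*x = trans (sym (2*n≡n+n (2 ^ d * last c))) (sym (*-assoc 2 (2 ^ d) (last c)))

chain-1,2,3,5 : Chain 3
chain-1,2,3,5 = record { term = t ; term-0 = refl ; term-< = t-< ; term-sum = t-sum }
  where
  t : ℕ → ℕ
  t 0 = 1
  t 1 = 2
  t 2 = 3
  t _ = 5
  t-< : ∀ {k} → k < 3 → t k < t (suc k)
  t-< {0} _ = ≤-refl
  t-< {1} _ = ≤-refl
  t-< {2} _ = n≤1+n 4
  t-< {suc (suc (suc _))} (s≤s (s≤s (s≤s ())))
  t-sum : ∀ {k} → 0 < k → k ≤ 3 → ∃[ i ] ∃[ j ] i < k × j < k × t k ≡ t i + t j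
  t-sum {1} _ _ = 0 , 0 , z<s , z<s , refl
  t-sum {2} _ _ = 1 , 0 , n<1+n 1 , z<s , refl
  t-sum {3} _ _ = 2 , 1 , n<1+n 2 , s<s z<s , refl
  t-sum {suc (suc (suc (suc _)))} _ (s≤s (s≤s (s≤s ())))

c₁-chain : ∀ m → Σ (Chain (m + 6)) λ c → last c ≡ c₁ m
c₁-chain m = subst (λ n → Σ (Chain n) λ c → last c ≡ c₁ m) (length m)
  (chain F , trans (ends F) (cong (_+ 3) (*-comm (2 ^ (m + 2)) 5)))
  where
  D : Extension chain-1,2,3,5 (m + 2 + 3) (2 ^ (m + 2) * 5)
  D = doublings chain-1,2,3,5 (m + 2)
  F : Extension chain-1,2,3,5 (suc (m + 2 + 3)) (2 ^ (m + 2) * 5 + 3)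
  F = D ▹ grows D (2 , n≤1+n 2 , refl)
  length : ∀ m → suc (m + 2 + 3) ≡ m + 6
  length = solve-∀

ℓ-c₁ : ∀ m → ℓ≡ (c₁ m) (m + 6)
ℓ-c₁ m with c₁-chain m
... | c , last≡ = toAdditionChain c last≡ , no-shorter
  where
  no-shorter : ∀ s → s < m + 6 → ¬ AdditionChain (c₁ m) s
  no-shorter s s<m+6 ch with fromAdditionChain ch
  ... | c′ , last≡′ = <⇒≱ s<m+6 (subst (_≤ s) (5+[m+1]≡m+6 m)
        (length≥5+n c′ (trans last≡′ (cong (λ x → 5 * 2 ^ x + 3) (+-suc m 1)))))
    where
    5+[m+1]≡m+6 : ∀ m → 5 + (m + 1) ≡ m + 6
    5+[m+1]≡m+6 = solve-∀

mersenne : ℕ → ℕ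
mersenne n = 2 ^ n ∸ 1

mersenne+1 : ∀ n → mersenne n + 1 ≡ 2 ^ n
mersenne+1 n = m∸n+n≡m (m^n>0 2 n)

2^d*mersenne[e]+mersenne[d]≡mersenne[e+d] : ∀ e d → 2 ^ d * mersenne e + mersenne d ≡ mersenne (e + d)
2^d*mersenne[e]+mersenne[d]≡mersenne[e+d] e d = +-cancelʳ-≡ _ _ _ (begin
  2 ^ d * mersenne e + mersenne d + 1   ≡⟨ +-assoc (2 ^ d * mersenne e) _ 1 ⟩
  2 ^ d * mersenne e + (mersenne d + 1) ≡⟨ cong (2 ^ d * mersenne e +_) (mersenne+1 d) ⟩
  2 ^ d * mersenne e + 2 ^ d            ≡⟨ cong (2 ^ d * mersenne e +_) (*-identityʳ (2 ^ d)) ⟨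
  2 ^ d * mersenne e + 2 ^ d * 1        ≡⟨ *-distribˡ-+ (2 ^ d) (mersenne e) 1 ⟨
  2 ^ d * (mersenne e + 1)              ≡⟨ cong (2 ^ d *_) (mersenne+1 e) ⟩
  2 ^ d * 2 ^ e                         ≡⟨ *-comm (2 ^ d) (2 ^ e) ⟩
  2 ^ e * 2 ^ d                         ≡⟨ ^-distribˡ-+-* 2 e d ⟨
  2 ^ (e + d)                           ≡⟨ mersenne+1 (e + d) ⟨
  mersenne (e + d) + 1                  ∎)
  where open ≡-Reasoning

mersenne-step : ∀ {r} (c : Chain r) e d → last c ≡ mersenne e → mersenne d ∈ c →
                Extension c (suc (d + r)) (mersenne (e + d))
mersenne-step {r} c e d last≡ m∈c = subst (Extension c _) value (D ▹ grows D m∈c)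
  where
  D : Extension c (d + r) (2 ^ d * last c)
  D = doublings c d
  value : 2 ^ d * last c + mersenne d ≡ mersenne (e + d)
  value = trans (cong (λ x → 2 ^ d * x + mersenne d) last≡) (2^d*mersenne[e]+mersenne[d]≡mersenne[e+d] e d)

mersenne-double : ∀ {r} (c : Chain r) e → last c ≡ mersenne e → Extension c (suc (e + r)) (mersenne (e + e))
mersenne-double c e last≡ = mersenne-step c e e last≡ (subst (_∈ c) last≡ (last-∈ c))

mersenne-triple : ∀ {r} (c : Chain r) e → last c ≡ mersenne e →
                  Extension c (suc (e + suc (e + r))) (mersenne (3 * e))
mersenne-triple {r} c e last≡ = subst (Extension c _) (cong mersenne (x+x+x≡3*x e))
  (E ⨾ mersenne-step (chain E) (e + e) e (ends E) (grows E (subst (_∈ c) last≡ (last-∈ c))))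
  where
  E : Extension c (suc (e + r)) (mersenne (e + e))
  E = mersenne-double c e last≡
  x+x+x≡3*x : ∀ x → x + x + x ≡ 3 * x
  x+x+x≡3*x = solve-∀

mersenne-2^-length : ℕ → ℕ
mersenne-2^-length zero    = 0
mersenne-2^-length (suc k) = suc (2 ^ k + mersenne-2^-length k)

mersenne-2^-length+1 : ∀ k → mersenne-2^-length k + 1 ≡ 2 ^ k + k
mersenne-2^-length+1 zero    = refl
mersenne-2^-length+1 (suc k) = begin
  suc (2 ^ k + mersenne-2^-length k) + 1   ≡⟨ cong suc (+-assoc (2 ^ k) (mersenne-2^-length k) 1) ⟩
  suc (2 ^ k + (mersenne-2^-length k + 1)) ≡⟨ cong (λ x → suc (2 ^ k + x)) (mersenne-2^-length+1 k) ⟩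
  suc (2 ^ k + (2 ^ k + k))                ≡⟨ identity (2 ^ k) k ⟩
  2 ^ suc k + suc k                        ∎
  where
  open ≡-Reasoning
  identity : ∀ x k → suc (x + (x + k)) ≡ 2 * x + suc k
  identity = solve-∀

mersenne-2^ : ∀ k → Extension singleton (mersenne-2^-length k) (mersenne (2 ^ k))
mersenne-2^ zero    = extension-refl singleton
mersenne-2^ (suc k) = subst (Extension singleton _) (cong mersenne (sym (2*n≡n+n (2 ^ k))))
  (E ⨾ mersenne-double (chain E) (2 ^ k) (ends E))
  where
  E : Extension singleton (mersenne-2^-length k) (mersenne (2 ^ k))
  E = mersenne-2^ k

mersenne[10q+3]-via-mersenne[3q+1] : ∀ {r} (c : Chain r) q → last c ≡ mersenne q →
  Σ (Chain (9 * q + 9 + r)) λ c′ → last c′ ≡ mersenne (10 * q + 3) × mersenne (3 * q + 1) ∈ c′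
mersenne[10q+3]-via-mersenne[3q+1] {r} c q last≡ =
  subst (λ n → Σ (Chain n) λ c′ → last c′ ≡ mersenne (10 * q + 3) × mersenne R ∈ c′) (length q r)
    (chain F , trans (ends F) (cong mersenne (value q)) , grows F (grows T₂ (ends-∈ S)))
  where
  R : ℕ
  R = 3 * q + 1
  T₁ : Extension c (suc (q + suc (q + r))) (mersenne (3 * q))
  T₁ = mersenne-triple c q last≡
  S : Extension (chain T₁) (suc (1 + suc (q + suc (q + r)))) (mersenne R)
  S = mersenne-step (chain T₁) (3 * q) 1 (ends T₁) (one-∈ (chain T₁))
  T₂ : Extension (chain S) (suc (R + suc (R + suc (1 + suc (q + suc (q + r)))))) (mersenne (3 * R))
  T₂ = mersenne-triple (chain S) R (ends S)
  F : Extension (chain T₂) (suc (q + suc (R + suc (R + suc (1 + suc (q + suc (q + r)))))))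
                (mersenne (3 * R + q))
  F = mersenne-step (chain T₂) (3 * R) q (ends T₂)
        ((grows T₂ ∘ grows S ∘ grows T₁) (subst (_∈ c) last≡ (last-∈ c)))
  length : ∀ q r → suc (q + suc (3 * q + 1 + suc (3 * q + 1 + suc (1 + suc (q + suc (q + r))))))
                   ≡ 9 * q + 9 + r
  length = solve-∀
  value : ∀ q → 3 * (3 * q + 1) + q ≡ 10 * q + 3
  value = solve-∀

mersenne-c₁-chain : ∀ m →
  Σ (Chain ((m + 6) + c₁ m)) λ c → last c ≡ mersenne (c₁ m) × mersenne (c₂ m) ∈ c
mersenne-c₁-chain m = subst (λ n → Σ (Chain n) λ c → last c ≡ mersenne (c₁ m) × mersenne (c₂ m) ∈ c)
  length (retarget (mersenne[10q+3]-via-mersenne[3q+1] (chain P) q (ends P)))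
  where
  q : ℕ
  q = 2 ^ (m + 1)
  P : Extension singleton (mersenne-2^-length (m + 1)) (mersenne q)
  P = mersenne-2^ (m + 1)
  10q+3≡c₁ : 10 * q + 3 ≡ c₁ m
  10q+3≡c₁ = begin
    10 * q + 3          ≡⟨ cong (_+ 3) (*-assoc 5 2 q) ⟩
    5 * (2 * q) + 3     ≡⟨ cong (λ x → 5 * 2 ^ x + 3) (+-suc m 1) ⟨
    c₁ m                ∎
    where open ≡-Reasoning
  retarget : ∀ {n} → Σ (Chain n) (λ c → last c ≡ mersenne (10 * q + 3) × mersenne (3 * q + 1) ∈ c) →
             Σ (Chain n) (λ c → last c ≡ mersenne (c₁ m) × mersenne (c₂ m) ∈ c)
  retarget (c , last≡ , c₂∈c) = c , trans last≡ (cong mersenne 10q+3≡c₁) , c₂∈c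
  length : 9 * q + 9 + mersenne-2^-length (m + 1) ≡ (m + 6) + c₁ m
  length = begin
    9 * q + 9 + mersenne-2^-length (m + 1)       ≡⟨ identity₁ q (mersenne-2^-length (m + 1)) ⟩
    9 * q + 8 + (mersenne-2^-length (m + 1) + 1) ≡⟨ cong (9 * q + 8 +_) (mersenne-2^-length+1 (m + 1)) ⟩
    9 * q + 8 + (q + (m + 1))                    ≡⟨ identity₂ m q ⟩
    (m + 6) + (10 * q + 3)                       ≡⟨ cong ((m + 6) +_) 10q+3≡c₁ ⟩
    (m + 6) + c₁ m                               ∎
    where
    open ≡-Reasoning
    identity₁ : ∀ q l → 9 * q + 9 + l ≡ 9 * q + 8 + (l + 1)
    identity₁ = solve-∀
    identity₂ : ∀ m q → 9 * q + 8 + (q + (m + 1)) ≡ (m + 6) + (10 * q + 3)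
    identity₂ = solve-∀

mainTheorem7 : (m : ℕ) → 1 ≤ m →
    ℓ≡ (c₁ m) (m + 6) ×
    Σ (AdditionChain (2 ^ c₁ m ∸ 1) ((m + 6) + c₁ m)) (λ ch → Contains ch (2 ^ c₂ m ∸ 1))
mainTheorem7 m _ = ℓ-c₁ m , toAdditionChain-∋ (mersenne-c₁-chain m)
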